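{- For every positive integer $n$: (i) $\mathrm{Comp}_{n+1}(S_n) = S_{n+1}$; (ii) if $n\ge 2$, then $\mathrm{Comp}_{n+1}(\{\iota_n\}) = \{\iota_{n+1}\}$; (iii) if $n \ge 3$, then $\mathrm{Comp}_{n+1}(\langle\delta_n\rangle) = \langle \delta_{n+1}\rangle$.
   Context: $S_n$ is the symmetric group on $[n]=\{1,\dots,n\}$; $\iota_n$ is the identity and $\delta_n$ the descending permutation $i\mapsto n+1-i$. A permutation $\pi\in S_m$ involves $\tau\in S_n$ ($n\le m$) if there are indices $i_1<\dots<i_n$ with $\pi(i_j)<\pi(i_k)$ iff $\tau(j)<\tau(k)$ for all $j,k$; such $\tau$ is an $n$-pattern of $\pi$. For $S\subseteq S_n$, $\mathrm{Comp}_m(S)$ is the set of all $\tau\in S_m$ all of whose $n$-patterns belong to $S$. -}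

module Defs where

open import Data.Nat using (ℕ; zero; suc)
open import Data.Fin using (Fin; _<_; opposite)
open import Data.Product using (Σ; _×_; ∃)
open import Data.Sum using (_⊎_)
open import Function.Bundles using (_⇔_)
open import Function.Definitions using (Injective)
open import Relation.Binary.PropositionalEquality using (_≡_)

-- An element of S_n: a permutation of Fin n = {0,…,n-1} (standing for [n]),
-- represented as an injective (hence bijective) map Fin n → Fin n.
IsPerm : (n : ℕ) → (Fin n → Fin n) → Set
IsPerm n f = Injective _≡_ _≡_ f

ι : (n : ℕ) → Fin n → Fin n
ι n i = i

δ : (n : ℕ) → Fin n → Fin n
δ n = opposite

pow : {n : ℕ} → (Fin n → Fin n) → ℕ → Fin n → Fin n
pow f zero i = i
pow f (suc k) i = f (pow f k i)

Sym : (n : ℕ) → (Fin n → Fin n) → Set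
Sym n σ = IsPerm n σ

SingletonId : (n : ℕ) → (Fin n → Fin n) → Set
SingletonId n σ = ∀ i → σ i ≡ ι n i

-- The cyclic subgroup ⟨δ_n⟩ of S_n (S_n finite, so nonnegative powers suffice).
Gen-δ : (n : ℕ) → (Fin n → Fin n) → Set
Gen-δ n σ = ∃ λ k → ∀ i → σ i ≡ pow (δ n) k i

Increasing : {n m : ℕ} → (Fin n → Fin m) → Set
Increasing {n} ix = ∀ (j k : Fin n) → j < k → ix j < ix k

IsPatternOf : (n m : ℕ) → (Fin n → Fin n) → (Fin m → Fin m) → Set
IsPatternOf n m τ π =
  Σ (Fin n → Fin m) λ ix → Increasing ix ×
    (∀ (j k : Fin n) → (π (ix j) < π (ix k)) ⇔ (τ j < τ k))

Comp : (n m : ℕ) → ((Fin n → Fin n) → Set) → (Fin m → Fin m) → Set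
Comp n m S τ =
  IsPerm m τ × (∀ (σ : Fin n → Fin n) → IsPerm n σ → IsPatternOf n m σ τ → S σ)

_≐_ : {m : ℕ} → ((Fin m → Fin m) → Set) → ((Fin m → Fin m) → Set) → Set
_≐_ {m} A B = ∀ (τ : Fin m → Fin m) → A τ ⇔ B τ

-- Delete the first and the last position of τ ∈ S_{n+1}. If both resulting
-- n-patterns are ι, then τ is increasing on every pair of positions avoiding
-- the first or avoiding the last one; for n+1 ≥ 3 the remaining pair
-- (first, last) is bridged through a middle position, so τ = ι. Composing
-- with the order reversal turns δ into ι, and for n+1 ≥ 4 the positions
-- 1 < 2 avoid both ends, so one deletion cannot be ι while the other is δ.
-- Conversely, every pattern of ι is ι, every pattern of δ is δ, and
-- ⟨δ⟩ = {ι, δ}.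
module Submission where

open import Defs
open import Data.Nat using (ℕ; zero; suc; _≤_)
open import Data.Product using (_×_; _,_; proj₁)
import Data.Nat as ℕ
import Data.Nat.Properties as ℕ
open import Data.Empty using (⊥; ⊥-elim)
open import Data.Fin using (Fin; zero; suc; toℕ; inject₁; fromℕ; opposite; punchIn; punchOut; _<_; _≟_)
open import Data.Fin.Properties
  using (toℕ<n; toℕ-injective; toℕ-inject₁; ≤̄⇒inject₁<; opposite-prop; opposite-involutive; <-asym;
         punchIn-injective; punchOut-injective; punchIn-cancel-≤; punchOut-cancel-≤;
         punchOut-mono-≤; punchInᵢ≢i; punchIn-punchOut; suc-injective)
open import Data.Sum as Sum using (_⊎_; inj₁; inj₂)
open import Function using (_∘_; id)
open import Function.Bundles using (_⇔_; mk⇔; Equivalence)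
import Function.Properties.Equivalence as ⇔
open import Relation.Binary.PropositionalEquality
open import Relation.Nullary using (¬_; yes; no)

private
  variable
    n m : ℕ

opposite-reverses-< : {i j : Fin n} → i < j → opposite j < opposite i
opposite-reverses-< {suc n} {i} {j} i<j =
  subst₂ ℕ._<_ (sym (opposite-prop j)) (sym (opposite-prop i))
    (ℕ.∸-monoʳ-< {m = suc n} (ℕ.s≤s i<j) (toℕ<n j))

opposite-reflects-< : {i j : Fin n} → opposite i < opposite j → j < i
opposite-reflects-< {i = i} {j} o<o =
  subst₂ _<_ (opposite-involutive j) (opposite-involutive i) (opposite-reverses-< o<o)

≗opposite⇒opposite∘≗id : {f : Fin n → Fin n} → f ≗ opposite → opposite ∘ f ≗ id
≗opposite⇒opposite∘≗id e i = trans (cong opposite (e i)) (opposite-involutive i)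

opposite∘≗id⇒≗opposite : {f : Fin n → Fin n} → opposite ∘ f ≗ id → f ≗ opposite
opposite∘≗id⇒≗opposite {f = f} e i =
  trans (sym (opposite-involutive (f i))) (cong opposite (e i))

≗id⇒increasing : {f : Fin n → Fin n} → f ≗ id → Increasing f
≗id⇒increasing e j k j<k = subst₂ _<_ (sym (e j)) (sym (e k)) j<k

increasing-inject₁ : {g : Fin (suc n) → Fin m} → Increasing g → Increasing (g ∘ inject₁)
increasing-inject₁ inc j k j<k =
  inc _ _ (subst₂ ℕ._<_ (sym (toℕ-inject₁ j)) (sym (toℕ-inject₁ k)) j<k)

increasing⇒≤ : {g : Fin n → Fin m} → Increasing g → ∀ i → toℕ i ≤ toℕ (g i)
increasing⇒≤ inc zero    = ℕ.z≤n
increasing⇒≤ inc (suc j) =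
  ℕ.≤-trans (ℕ.s≤s (increasing⇒≤ (increasing-inject₁ inc) j))
            (inc (inject₁ j) (suc j) (≤̄⇒inject₁< ℕ.≤-refl))

-- The upper bound is the lower bound for the conjugate by the order reversal.
increasing⇒≗id : {f : Fin n → Fin n} → Increasing f → f ≗ id
increasing⇒≗id {f = f} inc i =
  toℕ-injective (ℕ.≤-antisym (ℕ.≮⇒≥ i≮fi) (increasing⇒≤ inc i))
  where
  conjugate-increasing : Increasing (opposite ∘ f ∘ opposite)
  conjugate-increasing j k j<k = opposite-reverses-< (inc _ _ (opposite-reverses-< j<k))

  i≮fi : ¬ i < f i
  i≮fi i<fi = ℕ.<⇒≱ (opposite-reverses-< i<fi)
    (subst (λ x → toℕ (opposite i) ≤ toℕ (opposite (f x))) (opposite-involutive i)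
      (increasing⇒≤ conjugate-increasing (opposite i)))

≗id⇒isPerm : {f : Fin n → Fin n} → f ≗ id → IsPerm n f
≗id⇒isPerm e {x} {y} fx≡fy = trans (sym (e x)) (trans fx≡fy (e y))

IdOrOpposite : (n : ℕ) → (Fin n → Fin n) → Set
IdOrOpposite n σ = σ ≗ id ⊎ σ ≗ opposite

pow-δ : ∀ k → IdOrOpposite n (pow (δ n) k)
pow-δ zero    = inj₁ (λ _ → refl)
pow-δ (suc k) with pow-δ k
... | inj₁ e = inj₂ (cong opposite ∘ e)
... | inj₂ e = inj₁ (≗opposite⇒opposite∘≗id e)

Gen-δ⇔IdOrOpposite : (σ : Fin n → Fin n) → Gen-δ n σ ⇔ IdOrOpposite n σ
Gen-δ⇔IdOrOpposite {n} σ = mk⇔ to from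
  where
  to : Gen-δ n σ → IdOrOpposite n σ
  to (k , e) with pow-δ {n} k
  ... | inj₁ e′ = inj₁ (λ i → trans (e i) (e′ i))
  ... | inj₂ e′ = inj₂ (λ i → trans (e i) (e′ i))

  from : IdOrOpposite n σ → Gen-δ n σ
  from (inj₁ e) = 0 , e
  from (inj₂ e) = 1 , e

idOrOpposite⇒isPerm : {f : Fin n → Fin n} → IdOrOpposite n f → IsPerm n f
idOrOpposite⇒isPerm (inj₁ e) = ≗id⇒isPerm e
idOrOpposite⇒isPerm (inj₂ e) fx≡fy =
  ≗id⇒isPerm (≗opposite⇒opposite∘≗id e) (cong opposite fx≡fy)

Comp-cong : {S S′ : (Fin n → Fin n) → Set} → (∀ σ → S σ ⇔ S′ σ) →
            Comp n m S ≐ Comp n m S′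
Comp-cong S⇔S′ τ = mk⇔
  (λ (τ-perm , H) → τ-perm , λ σ σ-perm p → Equivalence.to   (S⇔S′ σ) (H σ σ-perm p))
  (λ (τ-perm , H) → τ-perm , λ σ σ-perm p → Equivalence.from (S⇔S′ σ) (H σ σ-perm p))

pattern-opposite : {σ : Fin n → Fin n} {τ : Fin m → Fin m} →
                   IsPatternOf n m σ τ → IsPatternOf n m (opposite ∘ σ) (opposite ∘ τ)
pattern-opposite (ix , ix-inc , ord) = ix , ix-inc , λ j k → mk⇔
  (λ o<o → opposite-reverses-< (Equivalence.to (ord k j) (opposite-reflects-< o<o)))
  (λ o<o → opposite-reverses-< (Equivalence.from (ord k j) (opposite-reflects-< o<o)))

increasing-along-pattern : {σ : Fin n → Fin n} {τ : Fin m → Fin m} →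
                           (p : IsPatternOf n m σ τ) → σ ≗ id → Increasing (τ ∘ proj₁ p)
increasing-along-pattern (_ , _ , ord) e j k j<k =
  Equivalence.from (ord j k) (≗id⇒increasing e j k j<k)

pattern-of-id : {σ : Fin n → Fin n} {τ : Fin m → Fin m} →
                IsPatternOf n m σ τ → τ ≗ id → σ ≗ id
pattern-of-id (ix , ix-inc , ord) e = increasing⇒≗id λ j k j<k →
  Equivalence.to (ord j k) (≗id⇒increasing e (ix j) (ix k) (ix-inc j k j<k))

pattern-of-idOrOpposite : {σ : Fin n → Fin n} {τ : Fin m → Fin m} →
                          IsPatternOf n m σ τ → IdOrOpposite m τ → IdOrOpposite n σ
pattern-of-idOrOpposite p (inj₁ e) = inj₁ (pattern-of-id p e)
pattern-of-idOrOpposite {τ = τ} p (inj₂ e) =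
  inj₂ (opposite∘≗id⇒≗opposite
    (pattern-of-id (pattern-opposite {τ = τ} p) (≗opposite⇒opposite∘≗id e)))

punchIn-increasing : (d : Fin (suc n)) → Increasing (punchIn d)
punchIn-increasing d j k j<k = ℕ.≰⇒> λ k≤j → ℕ.<⇒≱ j<k (punchIn-cancel-≤ d k j k≤j)

IncreasingOff : Fin n → (Fin n → Fin n) → Set
IncreasingOff d f = ∀ a b → d ≢ a → d ≢ b → a < b → f a < f b

increasingOff-punchIn : {f : Fin (suc n) → Fin (suc n)} (d : Fin (suc n)) →
                        Increasing (f ∘ punchIn d) → IncreasingOff d f
increasingOff-punchIn {f = f} d inc a b d≢a d≢b a<b =
  subst₂ (λ x y → f x < f y) (punchIn-punchOut d≢a) (punchIn-punchOut d≢b)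
    (inc _ _ (ℕ.≰⇒> λ b′≤a′ → ℕ.<⇒≱ a<b (punchOut-cancel-≤ d≢b d≢a b′≤a′)))

module Deletion (τ : Fin (suc n) → Fin (suc n)) (τ-perm : IsPerm (suc n) τ) (d : Fin (suc n)) where

  τd≢τ-punchIn : ∀ j → τ d ≢ τ (punchIn d j)
  τd≢τ-punchIn j eq = punchInᵢ≢i d j (τ-perm (sym eq))

  -- The standardisation of τ ∘ punchIn d: τ with position d removed and
  -- the values above τ d shifted down by one.
  deleteAt : Fin n → Fin n
  deleteAt j = punchOut (τd≢τ-punchIn j)

  deleteAt-isPerm : IsPerm n deleteAt
  deleteAt-isPerm {j} {k} eq =
    punchIn-injective d j k (τ-perm (punchOut-injective (τd≢τ-punchIn j) (τd≢τ-punchIn k) eq))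

  deleteAt-pattern : IsPatternOf n (suc n) deleteAt τ
  deleteAt-pattern = punchIn d , punchIn-increasing d , λ j k → mk⇔
    (λ a<b → ℕ.≰⇒> λ b≤a → ℕ.<⇒≱ a<b (punchOut-cancel-≤ (τd≢τ-punchIn k) (τd≢τ-punchIn j) b≤a))
    (λ s<t → ℕ.≰⇒> λ b≤a → ℕ.<⇒≱ s<t (punchOut-mono-≤ (τd≢τ-punchIn k) (τd≢τ-punchIn j) b≤a))

  deleteAt≗id⇒increasingOff : deleteAt ≗ id → IncreasingOff d τ
  deleteAt≗id⇒increasingOff e =
    increasingOff-punchIn d (increasing-along-pattern {τ = τ} deleteAt-pattern e)

  deleteAt≗opposite⇒increasingOff : deleteAt ≗ opposite → IncreasingOff d (opposite ∘ τ)
  deleteAt≗opposite⇒increasingOff e =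
    increasingOff-punchIn d (increasing-along-pattern {τ = opposite ∘ τ}
      (pattern-opposite {τ = τ} deleteAt-pattern) (≗opposite⇒opposite∘≗id e))

increasingOff-first-last⇒increasing : {f : Fin (3 ℕ.+ n) → Fin (3 ℕ.+ n)} →
  IncreasingOff zero f → IncreasingOff (fromℕ (2 ℕ.+ n)) f → Increasing f
increasingOff-first-last⇒increasing off₀ offₗ (suc a) (suc b) a<b =
  off₀ _ _ (λ ()) (λ ()) a<b
increasingOff-first-last⇒increasing {n} off₀ offₗ zero (suc b) a<b with b ≟ fromℕ (suc n)
... | yes refl = ℕ.<-trans (offₗ zero (suc zero) (λ ()) (λ ()) (ℕ.s≤s ℕ.z≤n))
                           (off₀ (suc zero) _ (λ ()) (λ ()) (ℕ.s≤s (ℕ.s≤s ℕ.z≤n)))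
... | no b≢last = offₗ zero (suc b) (λ ()) (b≢last ∘ sym ∘ suc-injective) a<b

increasingOff-both-ways-absurd : {f : Fin n → Fin n} {d d′ a b : Fin n} → a < b →
  d ≢ a → d ≢ b → d′ ≢ a → d′ ≢ b →
  IncreasingOff d f → IncreasingOff d′ (opposite ∘ f) → ⊥
increasingOff-both-ways-absurd a<b d≢a d≢b d′≢a d′≢b off off′ =
  <-asym (off _ _ d≢a d≢b a<b) (opposite-reflects-< (off′ _ _ d′≢a d′≢b a<b))

first-last⇒idOrOpposite : {f : Fin (4 ℕ.+ n) → Fin (4 ℕ.+ n)} →
  IncreasingOff zero f ⊎ IncreasingOff zero (opposite ∘ f) →
  IncreasingOff (fromℕ (3 ℕ.+ n)) f ⊎ IncreasingOff (fromℕ (3 ℕ.+ n)) (opposite ∘ f) →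
  IdOrOpposite (4 ℕ.+ n) f
first-last⇒idOrOpposite (inj₁ off₀) (inj₁ offₗ) =
  inj₁ (increasing⇒≗id (increasingOff-first-last⇒increasing off₀ offₗ))
first-last⇒idOrOpposite (inj₂ off₀) (inj₂ offₗ) =
  inj₂ (opposite∘≗id⇒≗opposite (increasing⇒≗id (increasingOff-first-last⇒increasing off₀ offₗ)))
first-last⇒idOrOpposite (inj₁ off₀) (inj₂ offₗ) =
  ⊥-elim (increasingOff-both-ways-absurd {a = suc zero} {b = suc (suc zero)}
    (ℕ.s≤s (ℕ.s≤s ℕ.z≤n)) (λ ()) (λ ()) (λ ()) (λ ()) off₀ offₗ)
first-last⇒idOrOpposite (inj₂ off₀) (inj₁ offₗ) =
  ⊥-elim (increasingOff-both-ways-absurd {a = suc zero} {b = suc (suc zero)}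
    (ℕ.s≤s (ℕ.s≤s ℕ.z≤n)) (λ ()) (λ ()) (λ ()) (λ ()) offₗ off₀)

Comp-Sym : ∀ n → Comp n (suc n) (Sym n) ≐ Sym (suc n)
Comp-Sym n τ = mk⇔ proj₁ (λ τ-perm → τ-perm , λ _ σ-perm _ → σ-perm)

Comp-SingletonId : ∀ n → Comp (2 ℕ.+ n) (3 ℕ.+ n) (SingletonId (2 ℕ.+ n)) ≐ SingletonId (3 ℕ.+ n)
Comp-SingletonId n τ = mk⇔ to from
  where
  to : Comp (2 ℕ.+ n) (3 ℕ.+ n) (SingletonId (2 ℕ.+ n)) τ → τ ≗ id
  to (τ-perm , H) = increasing⇒≗id (increasingOff-first-last⇒increasing
      (off zero) (off (fromℕ (2 ℕ.+ n))))
    where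
    open Deletion τ τ-perm
    off : ∀ d → IncreasingOff d τ
    off d = deleteAt≗id⇒increasingOff d (H (deleteAt d) (deleteAt-isPerm d) (deleteAt-pattern d))

  from : τ ≗ id → Comp (2 ℕ.+ n) (3 ℕ.+ n) (SingletonId (2 ℕ.+ n)) τ
  from e = ≗id⇒isPerm e , λ _ _ p → pattern-of-id p e

Comp-IdOrOpposite : ∀ n → Comp (3 ℕ.+ n) (4 ℕ.+ n) (IdOrOpposite (3 ℕ.+ n)) ≐ IdOrOpposite (4 ℕ.+ n)
Comp-IdOrOpposite n τ = mk⇔ to from
  where
  to : Comp (3 ℕ.+ n) (4 ℕ.+ n) (IdOrOpposite (3 ℕ.+ n)) τ → IdOrOpposite (4 ℕ.+ n) τ
  to (τ-perm , H) = first-last⇒idOrOpposite (off zero) (off (fromℕ (3 ℕ.+ n)))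
    where
    open Deletion τ τ-perm
    off : ∀ d → IncreasingOff d τ ⊎ IncreasingOff d (opposite ∘ τ)
    off d = Sum.map (deleteAt≗id⇒increasingOff d) (deleteAt≗opposite⇒increasingOff d)
              (H (deleteAt d) (deleteAt-isPerm d) (deleteAt-pattern d))

  from : IdOrOpposite (4 ℕ.+ n) τ → Comp (3 ℕ.+ n) (4 ℕ.+ n) (IdOrOpposite (3 ℕ.+ n)) τ
  from e = idOrOpposite⇒isPerm e , λ _ _ p → pattern-of-idOrOpposite p e

Comp-Gen-δ : ∀ n → Comp (3 ℕ.+ n) (4 ℕ.+ n) (Gen-δ (3 ℕ.+ n)) ≐ Gen-δ (4 ℕ.+ n)
Comp-Gen-δ n τ =
  ⇔.trans (Comp-cong Gen-δ⇔IdOrOpposite τ)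
    (⇔.trans (Comp-IdOrOpposite n τ) (⇔.sym (Gen-δ⇔IdOrOpposite τ)))

theorem4p3 : (n : ℕ) → 1 ≤ n →
    (Comp n (suc n) (Sym n) ≐ Sym (suc n))
    × (2 ≤ n → Comp n (suc n) (SingletonId n) ≐ SingletonId (suc n))
    × (3 ≤ n → Comp n (suc n) (Gen-δ n) ≐ Gen-δ (suc n))
theorem4p3 n _ = Comp-Sym n , part-ii n , part-iii n
  where
  part-ii : ∀ n → 2 ≤ n → Comp n (suc n) (SingletonId n) ≐ SingletonId (suc n)
  part-ii (suc (suc n)) _ = Comp-SingletonId n
  part-ii (suc zero) (ℕ.s≤s ())

  part-iii : ∀ n → 3 ≤ n → Comp n (suc n) (Gen-δ n) ≐ Gen-δ (suc n)
  part-iii (suc (suc (suc n))) _ = Comp-Gen-δ n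
  part-iii (suc (suc zero)) (ℕ.s≤s (ℕ.s≤s ()))
  part-iii (suc zero) (ℕ.s≤s ())
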